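{- Let $\mathcal{A}$ be a cluster algebra of type $\widetilde A_{m,n}$ (the surface cluster algebra of an annulus with $m$ marked points on one boundary component and $n$ on the other). Take any seed of $\mathcal{A}$ whose quiver contains a double arrow between two vertices $0$ and $1$, and let $a,b$ be the two further vertices of the subquiver attached to this double arrow (each forming a triangle with $0$ and $1$); write $x_v$ for the cluster variable at vertex $v$, with $x_a$ (resp. $x_b$) set equal to $1$ if that vertex is frozen. Then the growth (first growth coefficient) $\Theta$ of any infinite frieze pattern of type $\widetilde A_{m,n}$ is equal to $$\Theta=\frac{x_1}{x_0}+\frac{x_0}{x_1}+\frac{x_ax_b}{x_0x_1},$$ where the right-hand side is evaluated under the frieze (ring homomorphism $\mathcal{A}\to\mathbb{Z}$, positive on cluster variables) giving rise to the pattern.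
   Context: An infinite $n$-periodic frieze pattern is an infinite array of integers bounded above by a row of $0$'s followed by a row of $1$'s and satisfying the diamond rule $bc-ad=1$. Its growth (principal growth coefficient) is $s_1=x_{i,i+n+1}-x_{i+1,i+n}$, independent of $i$. Such patterns of type $\widetilde A_{m,n}$ arise from friezes on the annulus, i.e. ring homomorphisms from the surface cluster algebra to $\mathbb{Z}$ positive on all cluster variables; the growth equals the value of the frieze on the element of the cluster algebra corresponding to the unique simple closed curve in the annulus. The expression $\frac{x_1}{x_0}+\frac{x_0}{x_1}+\frac{x_ax_b}{x_0x_1}$ is this element written in a seed whose quiver has a double arrow. -}

module Defs where

open import Data.Nat as ℕ using (ℕ)
open import Data.Integer using (ℤ; +_; _+_; _-_; _*_; _<_; _≤_; -[1+_])
open import Data.Unit using (⊤)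
open import Data.Empty using (⊥)
open import Data.Product using (_×_)
open import Data.Sum using (_⊎_)
open import Relation.Nullary using (¬_)
open import Relation.Binary.PropositionalEquality using (_≡_; _≢_)

-- Combinatorial model of the annulus A_{m,n} via its universal cover
-- (an infinite strip).  Marked points on the outer boundary component
-- lift to  out i  (i ∈ ℤ), those on the inner one to  inn k  (k ∈ ℤ).
-- The deck transformation is  out i ↦ out (i + m), inn k ↦ inn (k + n).

data Pt : Set where
  out : ℤ → Pt
  inn : ℤ → Pt

shift : ℕ → ℕ → ℤ → Pt → Pt
shift m n t (out i) = out (i + t * + m)
shift m n t (inn k) = inn (k + t * + n)

-- Linear order on the boundary of the strip, obtained by cutting its
-- (cyclic) boundary order at -∞: outer points increasing, then +∞, then
-- inner points decreasing.
_≺_ : Pt → Pt → Set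
out i ≺ out j = i < j
out i ≺ inn k = ⊤
inn k ≺ out i = ⊥
inn k ≺ inn l = l < k

Between : Pt → Pt → Pt → Set
Between a b c = (a ≺ c × c ≺ b) ⊎ (b ≺ c × c ≺ a)

Cross : Pt → Pt → Pt → Pt → Set
Cross a b c d =
  (Between a b c × ¬ Between a b d × d ≢ a × d ≢ b) ⊎
  (Between a b d × ¬ Between a b c × c ≢ a × c ≢ b)

-- lifts of arcs of the annulus (peripheral arcs must be simple:
-- 2 ≤ |j - i| ≤ number of marked points on that component;
-- bridging arcs are all arcs)
Peri : ℕ → ℤ → ℤ → Set
Peri m i j = (+ 2 ≤ j - i × j - i ≤ + m) ⊎ (+ 2 ≤ i - j × i - j ≤ + m)

Arc : ℕ → ℕ → Pt → Pt → Set
Arc m n (out i) (out j) = Peri m i j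
Arc m n (inn k) (inn l) = Peri n k l
Arc m n (out i) (inn k) = ⊤
Arc m n (inn k) (out i) = ⊤

Bdry : Pt → Pt → Set
Bdry (out i) (out j) = (j - i ≡ + 1) ⊎ (i - j ≡ + 1)
Bdry (inn k) (inn l) = (l - k ≡ + 1) ⊎ (k - l ≡ + 1)
Bdry (out i) (inn k) = ⊥
Bdry (inn k) (out i) = ⊥

ArcOrBdry : ℕ → ℕ → Pt → Pt → Set
ArcOrBdry m n p q = Arc m n p q ⊎ Bdry p q

-- A frieze on the annulus A_{m,n}: a ring homomorphism from the surface
-- cluster algebra to ℤ, positive on cluster variables.  Equivalently:
-- an assignment of integers to (lifts of) arcs, deck-invariant, positive
-- on arcs, 1 on boundary segments (frozen variables), satisfying every
-- exchange relation, i.e. the Ptolemy relation of every flip.  A flip is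
-- a quadrilateral p1 ≺ p2 ≺ p3 ≺ p4 in the strip whose sides are arcs or
-- boundary segments and whose diagonals are arcs crossing exactly once in
-- the annulus (no nontrivial translate of one crosses the other).

record IsAnnulusFrieze (m n : ℕ) (F : Pt → Pt → ℤ) : Set where
  field
    symm  : ∀ p q → F p q ≡ F q p
    deck  : ∀ p q → F (shift m n (+ 1) p) (shift m n (+ 1) q) ≡ F p q
    bdry  : ∀ p q → Bdry p q → F p q ≡ + 1
    pos   : ∀ p q → Arc m n p q → + 0 < F p q
    exch  : ∀ p₁ p₂ p₃ p₄ → p₁ ≺ p₂ → p₂ ≺ p₃ → p₃ ≺ p₄ →
            ArcOrBdry m n p₁ p₂ → ArcOrBdry m n p₂ p₃ →
            ArcOrBdry m n p₃ p₄ → ArcOrBdry m n p₄ p₁ →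
            Arc m n p₁ p₃ → Arc m n p₂ p₄ →
            (∀ t → t ≢ + 0 →
               ¬ Cross p₁ p₃ (shift m n t p₂) (shift m n t p₄)) →
            F p₁ p₃ * F p₂ p₄ ≡ F p₁ p₂ * F p₃ p₄ + F p₂ p₃ * F p₄ p₁

-- The two infinite frieze patterns of type Ã_{m,n} attached to a frieze F
-- (outer one m-periodic, inner one n-periodic).  Entry (i,j) is the value
-- of F on the (generalised) peripheral arc from i to j in the strip, given
-- by the Ptolemy relation of the quadrilateral out i, out j, inn 0, inn -1
-- (resp. out 0, out 1, inn l, inn k).

outerEntry : (Pt → Pt → ℤ) → ℤ → ℤ → ℤ
outerEntry F i j =
  F (out i) (inn (+ 0)) * F (out j) (inn -[1+ 0 ]) -
  F (out j) (inn (+ 0)) * F (out i) (inn -[1+ 0 ])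

innerEntry : (Pt → Pt → ℤ) → ℤ → ℤ → ℤ
innerEntry F k l =
  F (out (+ 0)) (inn l) * F (out (+ 1)) (inn k) -
  F (out (+ 1)) (inn l) * F (out (+ 0)) (inn k)

outerGrowth : ℕ → (Pt → Pt → ℤ) → ℤ → ℤ
outerGrowth m F i =
  outerEntry F i (i + + (ℕ.suc m)) - outerEntry F (i + + 1) (i + + m)

innerGrowth : ℕ → (Pt → Pt → ℤ) → ℤ → ℤ
innerGrowth n F k =
  innerEntry F k (k + + (ℕ.suc n)) - innerEntry F (k + + 1) (k + + n)

{-# OPTIONS --safe #-}
module Submission where

-- The values x t l = F (out t) (inn l) on bridging arcs form an array whose
-- adjacent 2×2 minors are 1 (the Ptolemy relation of out t, out (t + 1),
-- inn (l + 1), inn l) and which is invariant under (t, l) ↦ (t + m, l + n).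
-- Its columns then satisfy three-term recurrences with coefficients that do not
-- depend on the row, so the minor of two rows is the same in all pairs of
-- adjacent columns, and every row is a combination of rows i and i + 1 with
-- minors as coefficients.  Expanding rows i - m and i + m in this way,
-- periodicity shows that their sum is Θ times row i, where Θ is the growth of
-- the outer frieze pattern, whose entries are exactly such row minors;
-- transposing gives the same for columns and the inner pattern.  At the double
-- arrow this says Θ x₁ = y + x₀ with y = x (i - m) (k + n), while the Ptolemy
-- relation of out (i - m), out i, inn (k + n), inn k says y x₀ = x_a x_b + x₁²;
-- eliminating y gives the formula.

open import Defs
open import Data.Nat using (ℕ; _≤_)
open import Data.Integer using (ℤ; +_; _+_; _-_; _*_)
open import Data.Product using (_×_)
open import Relation.Binary.PropositionalEquality using (_≡_)

open import Data.Nat as ℕ using (zero; suc; s≤s; z≤n)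
import Data.Nat.Properties as ℕₚ
open import Data.Integer using (-_; 0ℤ; 1ℤ; -1ℤ; -[1+_]; +[1+_]; ≢-nonZero; _<_; +<+; +≤+)
  renaming (_≤_ to _≤ℤ_)
open import Data.Integer.Properties
  using ( *-cancelʳ-≡; *-comm; *-identityˡ; *-identityʳ; +-identityʳ; +-assoc; +-comm
        ; neg-involutive; neg-distribˡ-*; pos-*; <-irrefl; ≤⇒≯; <⇒≢; +-monoʳ-<; +-monoʳ-≤
        ; i≤j⇒i-j≤0; i-j≤i; i≤i+j; module ≤-Reasoning)
open import Data.Integer.Tactic.RingSolver using (solve-∀; solve)
open import Data.List using ([]; _∷_)
open import Data.Product using (_,_)
open import Data.Sum using (_⊎_; inj₁; inj₂)
import Data.Sum as Sum
open import Data.Unit using (tt)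
open import Function using (flip; _∘′_)
open import Relation.Nullary using (¬_)
open import Relation.Binary.PropositionalEquality
  using (_≢_; refl; sym; trans; cong; cong₂; subst; module ≡-Reasoning)

suc-invariant⇒constant : ∀ {a} {A : Set a} (s : ℤ → A) →
                         (∀ i → s (i + 1ℤ) ≡ s i) → ∀ i j → s i ≡ s j
suc-invariant⇒constant s step i j = trans (to-origin i) (sym (to-origin j))
  where
  to-origin : ∀ i → s i ≡ s 0ℤ
  to-origin (+ zero)      = refl
  to-origin +[1+ n ]      =
    trans (cong (s ∘′ +_) (ℕₚ.+-comm 1 n)) (trans (step (+ n)) (to-origin (+ n)))
  to-origin -[1+ zero ]   = sym (step -1ℤ)
  to-origin -[1+ suc n ]  = trans (sym (step -[1+ suc n ])) (to-origin -[1+ n ])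

[i+j]+k≡[i+k]+j : ∀ i j k → (i + j) + k ≡ (i + k) + j
[i+j]+k≡[i+k]+j = solve-∀

[i-j]+j≡i : ∀ i j → (i - j) + j ≡ i
[i-j]+j≡i = solve-∀

[i+j]-j≡i : ∀ i j → (i + j) - j ≡ i
[i+j]-j≡i = solve-∀

[i+n]+1≡i+suc[n] : ∀ i n → (i + + n) + 1ℤ ≡ i + + suc n
[i+n]+1≡i+suc[n] i n = trans (+-assoc i (+ n) 1ℤ) (cong (_+_ i) (+-comm (+ n) 1ℤ))

[i+j]-i≡j : ∀ i j → (i + j) - i ≡ j
[i+j]-i≡j = solve-∀

i<i+n : ∀ i {n} → 1 ≤ n → i < i + + n
i<i+n i 1≤n = subst (_< i + + _) (+-identityʳ i) (+-monoʳ-< i (+<+ 1≤n))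

negative-multiple : ∀ q k → -[1+ q ] * + k ≡ - + (suc q ℕ.* k)
negative-multiple q k = trans (sym (neg-distribˡ-* +[1+ q ] (+ k))) (cong -_ (sym (pos-* (suc q) k)))

*-cancel-crossed : ∀ κ κ′ {a b} → a ≢ 0ℤ → b ≢ 0ℤ → (κ * a) * b ≡ (κ′ * b) * a → κ ≡ κ′
*-cancel-crossed κ κ′ {a} {b} a≢0 b≢0 eq =
  *-cancelʳ-≡ κ κ′ a {{≢-nonZero a≢0}}
    (*-cancelʳ-≡ (κ * a) (κ′ * a) b {{≢-nonZero b≢0}}
      (trans eq (solve (κ′ ∷ a ∷ b ∷ []))))

module UnimodularBlock (a₀ a₁ a₂ b₀ b₁ b₂ : ℤ)
                       (unimodular₀ : a₁ * b₀ - b₁ * a₀ ≡ 1ℤ)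
                       (unimodular₁ : a₂ * b₁ - b₂ * a₁ ≡ 1ℤ) where
  open ≡-Reasoning

  three-term : a₀ + a₂ ≡ (a₂ * b₀ - a₀ * b₂) * a₁
  three-term = begin
    a₀ + a₂
      ≡⟨ solve (a₀ ∷ a₂ ∷ []) ⟩
    a₀ * 1ℤ + a₂ * 1ℤ
      ≡⟨ cong₂ (λ u v → a₀ * u + a₂ * v) (sym unimodular₁) (sym unimodular₀) ⟩
    a₀ * (a₂ * b₁ - b₂ * a₁) + a₂ * (a₁ * b₀ - b₁ * a₀)
      ≡⟨ solve (a₀ ∷ a₁ ∷ a₂ ∷ b₀ ∷ b₁ ∷ b₂ ∷ []) ⟩
    (a₂ * b₀ - a₀ * b₂) * a₁ ∎

  cross : (a₀ + a₂) * b₁ ≡ (b₀ + b₂) * a₁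
  cross = begin
    (a₀ + a₂) * b₁
      ≡⟨ solve (a₀ ∷ a₁ ∷ a₂ ∷ b₀ ∷ b₁ ∷ b₂ ∷ []) ⟩
    (b₀ + b₂) * a₁ + ((a₂ * b₁ - b₂ * a₁) - (a₁ * b₀ - b₁ * a₀))
      ≡⟨ cong₂ (λ u v → (b₀ + b₂) * a₁ + (u - v)) unimodular₁ unimodular₀ ⟩
    (b₀ + b₂) * a₁ + 0ℤ
      ≡⟨ +-identityʳ _ ⟩
    (b₀ + b₂) * a₁ ∎

-- Columns are taken in decreasing order, so that the unimodularity of
-- adjacent minors below is the diamond rule of a frieze.
minor : (ℤ → ℤ → ℤ) → ℤ → ℤ → ℤ → ℤ
minor f l a c = f a (l + 1ℤ) * f c l - f c (l + 1ℤ) * f a l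

minor-antisym : ∀ f l a c → minor f l c a ≡ - minor f l a c
minor-antisym f l a c = antisym (f a (l + 1ℤ)) (f a l) (f c (l + 1ℤ)) (f c l)
  where
  antisym : ∀ a₁ a₀ c₁ c₀ → c₁ * a₀ - a₁ * c₀ ≡ - (a₁ * c₀ - c₁ * a₀)
  antisym = solve-∀

minor-linear : ∀ f l j α {x y z} → (∀ l → f x l + f z l ≡ α * f y l) →
               minor f l j x + minor f l j z ≡ α * minor f l j y
minor-linear f l j α {x} {y} {z} relation = begin
  (j₁ * f x l - f x l₁ * j₀) + (j₁ * f z l - f z l₁ * j₀)
    ≡⟨ expand j₁ j₀ (f x l) (f x l₁) (f z l) (f z l₁) ⟩
  j₁ * (f x l + f z l) - (f x l₁ + f z l₁) * j₀
    ≡⟨ cong₂ (λ u v → j₁ * u - v * j₀) (relation l) (relation l₁) ⟩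
  j₁ * (α * f y l) - (α * f y l₁) * j₀
    ≡⟨ factor α j₁ j₀ (f y l) (f y l₁) ⟩
  α * (j₁ * f y l - f y l₁ * j₀) ∎
  where
  open ≡-Reasoning
  l₁ j₁ j₀ : ℤ
  l₁ = l + 1ℤ
  j₁ = f j l₁
  j₀ = f j l
  expand : ∀ j₁ j₀ x₀ x₁ z₀ z₁ →
           (j₁ * x₀ - x₁ * j₀) + (j₁ * z₀ - z₁ * j₀) ≡ j₁ * (x₀ + z₀) - (x₁ + z₁) * j₀
  expand = solve-∀
  factor : ∀ α j₁ j₀ y₀ y₁ → j₁ * (α * y₀) - (α * y₁) * j₀ ≡ α * (j₁ * y₀ - y₁ * j₀)
  factor = solve-∀

minor-cramer : ∀ f l a b c → minor f l a b * f c l ≡ minor f l a c * f b l - minor f l b c * f a l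
minor-cramer f l a b c = cramer (f a (l + 1ℤ)) (f a l) (f b (l + 1ℤ)) (f b l) (f c (l + 1ℤ)) (f c l)
  where
  cramer : ∀ a₁ a₀ b₁ b₀ c₁ c₀ →
           (a₁ * b₀ - b₁ * a₀) * c₀ ≡ (a₁ * c₀ - c₁ * a₀) * b₀ - (b₁ * c₀ - c₁ * b₀) * a₀
  cramer = solve-∀

minor-suc : ∀ f l a c κ → f a l + f a ((l + 1ℤ) + 1ℤ) ≡ κ * f a (l + 1ℤ) →
                          f c l + f c ((l + 1ℤ) + 1ℤ) ≡ κ * f c (l + 1ℤ) →
            minor f (l + 1ℤ) a c ≡ minor f l a c
minor-suc f l a c κ recurrenceᵃ recurrenceᶜ = begin
  a₂ * c₁ - c₂ * a₁
    ≡⟨ split a₀ a₁ a₂ c₀ c₁ c₂ ⟩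
  (a₁ * c₀ - c₁ * a₀) + ((a₀ + a₂) * c₁ - (c₀ + c₂) * a₁)
    ≡⟨ cong₂ (λ u v → (a₁ * c₀ - c₁ * a₀) + (u * c₁ - v * a₁)) recurrenceᵃ recurrenceᶜ ⟩
  (a₁ * c₀ - c₁ * a₀) + ((κ * a₁) * c₁ - (κ * c₁) * a₁)
    ≡⟨ cancel κ a₀ a₁ c₀ c₁ ⟩
  a₁ * c₀ - c₁ * a₀ ∎
  where
  open ≡-Reasoning
  a₀ a₁ a₂ c₀ c₁ c₂ : ℤ
  a₀ = f a l
  a₁ = f a (l + 1ℤ)
  a₂ = f a ((l + 1ℤ) + 1ℤ)
  c₀ = f c l
  c₁ = f c (l + 1ℤ)
  c₂ = f c ((l + 1ℤ) + 1ℤ)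
  split : ∀ a₀ a₁ a₂ c₀ c₁ c₂ →
          a₂ * c₁ - c₂ * a₁ ≡ (a₁ * c₀ - c₁ * a₀) + ((a₀ + a₂) * c₁ - (c₀ + c₂) * a₁)
  split = solve-∀
  cancel : ∀ κ a₀ a₁ c₀ c₁ →
           (a₁ * c₀ - c₁ * a₀) + ((κ * a₁) * c₁ - (κ * c₁) * a₁) ≡ a₁ * c₀ - c₁ * a₀
  cancel = solve-∀

record IsSL₂Tiling (f : ℤ → ℤ → ℤ) : Set where
  field
    unimodular : ∀ t l → minor f l t (t + 1ℤ) ≡ 1ℤ
    nonzero    : ∀ t l → f t l ≢ 0ℤ

transpose-isSL₂Tiling : ∀ {f} → IsSL₂Tiling f → IsSL₂Tiling (flip f)
transpose-isSL₂Tiling {f} tiling = record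
  { unimodular = λ t l → trans (cong (_- f (l + 1ℤ) (t + 1ℤ) * f l t) (*-comm (f (l + 1ℤ) t) (f l (t + 1ℤ))))
                               (unimodular l t)
  ; nonzero    = λ t l → nonzero l t
  }
  where open IsSL₂Tiling tiling

module SL₂Tiling {f : ℤ → ℤ → ℤ} (tiling : IsSL₂Tiling f) where
  open IsSL₂Tiling tiling
  open ≡-Reasoning

  module Block (t l : ℤ) =
    UnimodularBlock (f t l) (f t (l + 1ℤ)) (f t ((l + 1ℤ) + 1ℤ))
                    (f (t + 1ℤ) l) (f (t + 1ℤ) (l + 1ℤ)) (f (t + 1ℤ) ((l + 1ℤ) + 1ℤ))
                    (unimodular t l) (unimodular t (l + 1ℤ))

  columnCoefficient : ℤ → ℤ → ℤ
  columnCoefficient t l = f t ((l + 1ℤ) + 1ℤ) * f (t + 1ℤ) l - f t l * f (t + 1ℤ) ((l + 1ℤ) + 1ℤ)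

  column-three-term : ∀ t l → f t l + f t ((l + 1ℤ) + 1ℤ) ≡ columnCoefficient t l * f t (l + 1ℤ)
  column-three-term = Block.three-term

  -- Cross-multiply the three-term relations of rows t and t + 1; this is where
  -- the entries have to be nonzero.
  columnCoefficient-suc : ∀ t l → columnCoefficient (t + 1ℤ) l ≡ columnCoefficient t l
  columnCoefficient-suc t l = sym (*-cancel-crossed (columnCoefficient t l) (columnCoefficient (t + 1ℤ) l)
    (nonzero t (l + 1ℤ)) (nonzero (t + 1ℤ) (l + 1ℤ)) (begin
      (columnCoefficient t l * f t (l + 1ℤ)) * f (t + 1ℤ) (l + 1ℤ)
        ≡⟨ cong (_* f (t + 1ℤ) (l + 1ℤ)) (sym (column-three-term t l)) ⟩
      (f t l + f t ((l + 1ℤ) + 1ℤ)) * f (t + 1ℤ) (l + 1ℤ)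
        ≡⟨ Block.cross t l ⟩
      (f (t + 1ℤ) l + f (t + 1ℤ) ((l + 1ℤ) + 1ℤ)) * f t (l + 1ℤ)
        ≡⟨ cong (_* f t (l + 1ℤ)) (column-three-term (t + 1ℤ) l) ⟩
      (columnCoefficient (t + 1ℤ) l * f (t + 1ℤ) (l + 1ℤ)) * f t (l + 1ℤ) ∎))

  column-recurrence : ∀ t l → f t l + f t ((l + 1ℤ) + 1ℤ) ≡ columnCoefficient 0ℤ l * f t (l + 1ℤ)
  column-recurrence t l =
    trans (column-three-term t l)
          (cong (_* f t (l + 1ℤ))
                (suc-invariant⇒constant (flip columnCoefficient l) (flip columnCoefficient-suc l) t 0ℤ))

  minor-invariant : ∀ l l′ a c → minor f l a c ≡ minor f l′ a c
  minor-invariant l l′ a c = suc-invariant⇒constant (λ l → minor f l a c)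
    (λ l → minor-suc f l a c (columnCoefficient 0ℤ l) (column-recurrence a l) (column-recurrence c l)) l l′

  row-expansion : ∀ i c l → f c l ≡ minor f l i c * f (i + 1ℤ) l - minor f l (i + 1ℤ) c * f i l
  row-expansion i c l = begin
    f c l                                        ≡⟨ sym (*-identityˡ (f c l)) ⟩
    1ℤ * f c l                                   ≡⟨ cong (_* f c l) (sym (unimodular i l)) ⟩
    minor f l i (i + 1ℤ) * f c l                 ≡⟨ minor-cramer f l i (i + 1ℤ) c ⟩
    minor f l i c * f (i + 1ℤ) l - minor f l (i + 1ℤ) c * f i l ∎

  module Periodic (p q : ℕ) (periodic : ∀ t l → f (t + + p) (l + + q) ≡ f t l) where

    minor-periodic : ∀ l a c → minor f l (a + + p) (c + + p) ≡ minor f l a c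
    minor-periodic l a c = begin
      minor f l (a + + p) (c + + p)         ≡⟨ minor-invariant l (l + + q) (a + + p) (c + + p) ⟩
      minor f (l + + q) (a + + p) (c + + p) ≡⟨ cong₂ _-_ (cong₂ _*_ (periodic₁ a) (periodic c l))
                                                        (cong₂ _*_ (periodic₁ c) (periodic a l)) ⟩
      minor f l a c                         ∎
      where
      periodic₁ : ∀ t → f (t + + p) ((l + + q) + 1ℤ) ≡ f t (l + 1ℤ)
      periodic₁ t = trans (cong (f (t + + p)) ([i+j]+k≡[i+k]+j l (+ q) 1ℤ)) (periodic t (l + 1ℤ))

    growth : ℤ → ℤ → ℤ
    growth l j = minor f l j (j + + suc p) - minor f l (j + 1ℤ) (j + + p)

    -- Expand rows j and j + 2p in the basis of rows j + p and j + p + 1: by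
    -- periodicity the coefficients of row j + p + 1 cancel.
    period-recurrence : ∀ l′ j l → f j l + f ((j + + p) + + p) l ≡ growth l′ j * f (j + + p) l
    period-recurrence l′ j l = begin
      f j l + f i₊ l
        ≡⟨ cong₂ _+_ (row-expansion i j l) (row-expansion i i₊ l) ⟩
      (minor f l i j * f (i + 1ℤ) l - ν * f i l) + (μ * f (i + 1ℤ) l - ν′ * f i l)
        ≡⟨ cong (λ x → (x * f (i + 1ℤ) l - ν * f i l) + (μ * f (i + 1ℤ) l - ν′ * f i l)) backward ⟩
      (- μ * f (i + 1ℤ) l - ν * f i l) + (μ * f (i + 1ℤ) l - ν′ * f i l)
        ≡⟨ opposite-cancel μ ν ν′ (f (i + 1ℤ) l) (f i l) ⟩
      (- ν - ν′) * f i l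
        ≡⟨ cong (_* f i l) (cong₂ _-_ first second) ⟩
      growth l j * f i l
        ≡⟨ cong (_* f i l) (cong₂ _-_ (minor-invariant l l′ _ _) (minor-invariant l l′ _ _)) ⟩
      growth l′ j * f i l ∎
      where
      i i₊ μ ν ν′ : ℤ
      i  = j + + p
      i₊ = i + + p
      μ  = minor f l i i₊
      ν  = minor f l (i + 1ℤ) j
      ν′ = minor f l (i + 1ℤ) i₊
      backward : minor f l i j ≡ - μ
      backward = trans (minor-antisym f l j i) (cong -_ (sym (minor-periodic l j i)))
      opposite-cancel : ∀ μ ν ν′ y z → (- μ * y - ν * z) + (μ * y - ν′ * z) ≡ (- ν - ν′) * z
      opposite-cancel = solve-∀
      first : - ν ≡ minor f l j (j + + suc p)
      first = trans (cong -_ (minor-antisym f l j (i + 1ℤ)))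
                    (trans (neg-involutive _) (cong (minor f l j) ([i+n]+1≡i+suc[n] j p)))
      second : ν′ ≡ minor f l (j + 1ℤ) (j + + p)
      second = trans (cong (λ x → minor f l x i₊) ([i+j]+k≡[i+k]+j j (+ p) 1ℤ))
                     (minor-periodic l (j + 1ℤ) i)

    -- Taking minors against row j + p of the period recurrence for j + 1
    -- turns it into an identity between consecutive growths.
    growth-suc : ∀ l j → growth l (j + 1ℤ) ≡ growth l j
    growth-suc l j = begin
      growth l J
        ≡⟨ sym (*-identityʳ (growth l J)) ⟩
      growth l J * 1ℤ
        ≡⟨ cong (growth l J *_) (sym (unimodular r l)) ⟩
      growth l J * minor f l r (r + 1ℤ)
        ≡⟨ cong (λ x → growth l J * minor f l r x) (sym J+p≡r+1) ⟩
      growth l J * minor f l r (J + + p)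
        ≡⟨ sym (minor-linear f l r (growth l J) (period-recurrence l J)) ⟩
      minor f l r J + minor f l r ((J + + p) + + p)
        ≡⟨ cong₂ _+_ (minor-antisym f l J r) (minor-periodic l j (J + + p)) ⟩
      - minor f l J r + minor f l j (J + + p)
        ≡⟨ +-comm (- minor f l J r) _ ⟩
      minor f l j (J + + p) - minor f l J r
        ≡⟨ cong (λ x → minor f l j x - minor f l J r) (trans J+p≡r+1 ([i+n]+1≡i+suc[n] j p)) ⟩
      growth l j ∎
      where
      J r : ℤ
      J = j + 1ℤ
      r = j + + p
      J+p≡r+1 : J + + p ≡ r + 1ℤ
      J+p≡r+1 = sym ([i+j]+k≡[i+k]+j j (+ p) 1ℤ)

    growth-recurrence : ∀ l′ j i l → growth l′ j * f i l ≡ f (i - + p) l + f (i + + p) l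
    growth-recurrence l′ j i l = begin
      growth l′ j * f i l
        ≡⟨ cong (_* f i l) (suc-invariant⇒constant (growth l′) (growth-suc l′) j (i - + p)) ⟩
      growth l′ (i - + p) * f i l
        ≡⟨ subst (λ x → growth l′ (i - + p) * f x l ≡ f (i - + p) l + f (x + + p) l)
                 ([i-j]+j≡i i (+ p)) (sym (period-recurrence l′ (i - + p) l)) ⟩
      f (i - + p) l + f (i + + p) l ∎

≺-irrefl : ∀ p → ¬ p ≺ p
≺-irrefl (out i) = <-irrefl refl
≺-irrefl (inn k) = <-irrefl refl

¬Cross-endpoint : ∀ a b c → ¬ Cross a b c b
¬Cross-endpoint a b c (inj₁ (_ , _ , _ , b≢b))         = b≢b refl
¬Cross-endpoint a b c (inj₂ (inj₁ (_ , b≺b) , _))     = ≺-irrefl b b≺b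
¬Cross-endpoint a b c (inj₂ (inj₂ (b≺b , _) , _))     = ≺-irrefl b b≺b

¬Cross-bothBetween : ∀ {a b c d} → Between a b c → Between a b d → ¬ Cross a b c d
¬Cross-bothBetween c∈ab d∈ab (inj₁ (_ , d∉ab , _)) = d∉ab d∈ab
¬Cross-bothBetween c∈ab d∈ab (inj₂ (_ , c∉ab , _)) = c∉ab c∈ab

¬Cross-neitherBetween : ∀ {a b c d} → ¬ Between a b c → ¬ Between a b d → ¬ Cross a b c d
¬Cross-neitherBetween c∉ab d∉ab (inj₁ (c∈ab , _)) = c∉ab c∈ab
¬Cross-neitherBetween c∉ab d∉ab (inj₂ (d∈ab , _)) = d∉ab d∈ab

-- A forward translate of the diagonal out (A + α) – inn B has both endpoints
-- between the ends of the diagonal out A – inn (B + β) (or ends at inn (B + β)),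
-- a backward translate has neither.
module ShortBridgingDiagonals {m n α β : ℕ} (1≤α : 1 ≤ α) (α≤m : α ≤ m) (β≤n : β ≤ n) (A B : ℤ)
  where

  a b : Pt
  a = out A
  b = inn (B + + β)

  between-out : ∀ {x} → A < x → Between a b (out x)
  between-out A<x = inj₁ (A<x , tt)

  between-out⁻¹ : ∀ {x} → Between a b (out x) → A < x
  between-out⁻¹ (inj₁ (A<x , _)) = A<x
  between-out⁻¹ (inj₂ (() , _))

  between-inn : ∀ {y} → B + + β < y → Between a b (inn y)
  between-inn b<y = inj₁ (tt , b<y)

  between-inn⁻¹ : ∀ {y} → Between a b (inn y) → B + + β < y
  between-inn⁻¹ (inj₁ (_ , b<y)) = b<y
  between-inn⁻¹ (inj₂ (_ , ()))

  c d : ℤ → Pt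
  c u = shift m n u (out (A + + α))
  d u = shift m n u (inn B)

  forward : ∀ q → ¬ Cross a b (c +[1+ q ]) (d +[1+ q ])
  forward q with ℕₚ.m≤n⇒m<n∨m≡n (ℕₚ.≤-trans β≤n (ℕₚ.m≤n*m n (suc q)))
  ... | inj₁ β<[1+q]n = ¬Cross-bothBetween (between-out c-after-A) (between-inn d-after-b)
    where
    c-after-A : A < (A + + α) + +[1+ q ] * + m
    c-after-A = subst (A <_) (trans (sym (+-assoc A (+ α) _)) (cong (_+_ (A + + α)) (pos-* (suc q) m)))
                      (i<i+n A (ℕₚ.≤-trans 1≤α (ℕₚ.m≤m+n α _)))
    d-after-b : B + + β < B + +[1+ q ] * + n
    d-after-b = subst (B + + β <_) (cong (_+_ B) (pos-* (suc q) n)) (+-monoʳ-< B (+<+ β<[1+q]n))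
  ... | inj₂ β≡[1+q]n = subst (λ x → ¬ Cross a b (c +[1+ q ]) x) d≡b (¬Cross-endpoint a b (c +[1+ q ]))
    where
    d≡b : b ≡ d +[1+ q ]
    d≡b = cong (λ v → inn (B + v)) (trans (cong +_ β≡[1+q]n) (pos-* (suc q) n))

  backward : ∀ q → ¬ Cross a b (c -[1+ q ]) (d -[1+ q ])
  backward q = ¬Cross-neitherBetween (λ c∈ab → ≤⇒≯ c≤A (between-out⁻¹ c∈ab))
                                     (λ d∈ab → ≤⇒≯ d≤b (between-inn⁻¹ d∈ab))
    where
    open ≤-Reasoning
    α≤[1+q]m : α ≤ suc q ℕ.* m
    α≤[1+q]m = ℕₚ.≤-trans α≤m (ℕₚ.m≤n*m m (suc q))
    c≤A : (A + + α) + -[1+ q ] * + m ≤ℤ A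
    c≤A = begin
      (A + + α) + -[1+ q ] * + m      ≡⟨ cong (_+_ (A + + α)) (negative-multiple q m) ⟩
      (A + + α) - + (suc q ℕ.* m)     ≡⟨ +-assoc A (+ α) _ ⟩
      A + (+ α - + (suc q ℕ.* m))     ≤⟨ +-monoʳ-≤ A (i≤j⇒i-j≤0 (+≤+ α≤[1+q]m)) ⟩
      A + 0ℤ                          ≡⟨ +-identityʳ A ⟩
      A                               ∎
    d≤b : B + -[1+ q ] * + n ≤ℤ B + + β
    d≤b = begin
      B + -[1+ q ] * + n   ≡⟨ cong (_+_ B) (negative-multiple q n) ⟩
      B - + (suc q ℕ.* n)  ≤⟨ i-j≤i B (+ (suc q ℕ.* n)) ⟩
      B                    ≤⟨ i≤i+j B (+ β) ⟩
      B + + β              ∎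

  cross-once : ∀ u → u ≢ 0ℤ → ¬ Cross a b (c u) (d u)
  cross-once (+ zero)   0≢0 = λ _ → 0≢0 refl
  cross-once +[1+ q ]   _   = forward q
  cross-once -[1+ q ]   _   = backward q

short-difference : ∀ {α k} → 1 ≤ α → α ≤ k → ∀ X →
                   (+ 2 ≤ℤ (X + + α) - X × (X + + α) - X ≤ℤ + k) ⊎ (X + + α) - X ≡ + 1
short-difference {α} {k} 1≤α α≤k X =
  subst (λ δ → (+ 2 ≤ℤ δ × δ ≤ℤ + k) ⊎ δ ≡ + 1) (sym ([i+j]-i≡j X (+ α))) (short 1≤α α≤k)
  where
  short : ∀ {α} → 1 ≤ α → α ≤ k → (+ 2 ≤ℤ + α × + α ≤ℤ + k) ⊎ + α ≡ + 1
  short {suc zero}    _ _   = inj₂ refl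
  short {suc (suc _)} _ α≤k = inj₁ (+≤+ (s≤s (s≤s z≤n)) , +≤+ α≤k)

short-outer-side : ∀ {m n α} → 1 ≤ α → α ≤ m → ∀ A → ArcOrBdry m n (out A) (out (A + + α))
short-outer-side 1≤α α≤m A = Sum.map inj₁ inj₁ (short-difference 1≤α α≤m A)

short-inner-side : ∀ {m n β} → 1 ≤ β → β ≤ n → ∀ B → ArcOrBdry m n (inn (B + + β)) (inn B)
short-inner-side 1≤β β≤n B = Sum.map inj₂ inj₂ (short-difference 1≤β β≤n B)

module AnnulusFrieze {m n : ℕ} (1≤m : 1 ≤ m) (1≤n : 1 ≤ n) {F : Pt → Pt → ℤ} (frieze : IsAnnulusFrieze m n F)
  where
  open IsAnnulusFrieze frieze

  bridge : ℤ → ℤ → ℤ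
  bridge t l = F (out t) (inn l)

  ptolemy-short-bridging : ∀ {α β} → 1 ≤ α → α ≤ m → 1 ≤ β → β ≤ n → ∀ A B →
    bridge A (B + + β) * bridge (A + + α) B ≡
    F (out A) (out (A + + α)) * F (inn (B + + β)) (inn B) + bridge (A + + α) (B + + β) * bridge A B
  ptolemy-short-bridging {α} {β} 1≤α α≤m 1≤β β≤n A B =
    trans (exch (out A) (out (A + + α)) (inn (B + + β)) (inn B)
                (i<i+n A 1≤α) tt (i<i+n B 1≤β)
                (short-outer-side {n = n} 1≤α α≤m A) (inj₁ tt) (short-inner-side {m = m} 1≤β β≤n B) (inj₁ tt)
                tt tt
                (ShortBridgingDiagonals.cross-once 1≤α α≤m β≤n A B))
          (cong (λ x → F (out A) (out (A + + α)) * F (inn (B + + β)) (inn B) + bridge (A + + α) (B + + β) * x)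
                (symm (inn B) (out A)))

  bridge-isSL₂Tiling : IsSL₂Tiling bridge
  bridge-isSL₂Tiling = record
    { unimodular = λ t l → trans (cong (_- bridge (t + 1ℤ) (l + 1ℤ) * bridge t l) (diamond t l))
                                 ([i+j]-j≡i 1ℤ (bridge (t + 1ℤ) (l + 1ℤ) * bridge t l))
    ; nonzero    = λ t l F≡0 → <⇒≢ (pos (out t) (inn l) tt) (sym F≡0)
    }
    where
    diamond : ∀ t l → bridge t (l + 1ℤ) * bridge (t + 1ℤ) l ≡ 1ℤ + bridge (t + 1ℤ) (l + 1ℤ) * bridge t l
    diamond t l = trans (ptolemy-short-bridging ℕₚ.≤-refl 1≤m ℕₚ.≤-refl 1≤n t l)
      (cong (λ x → x + bridge (t + 1ℤ) (l + 1ℤ) * bridge t l)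
            (cong₂ _*_ (bdry (out t) (out (t + 1ℤ)) (inj₁ ([i+j]-i≡j t 1ℤ)))
                       (bdry (inn (l + 1ℤ)) (inn l) (inj₂ ([i+j]-i≡j l 1ℤ)))))

  bridge-periodic : ∀ t l → bridge (t + + m) (l + + n) ≡ bridge t l
  bridge-periodic t l =
    trans (cong₂ (λ x y → F (out (t + x)) (inn (l + y))) (sym (*-identityˡ (+ m))) (sym (*-identityˡ (+ n))))
          (deck (out t) (inn l))

  bridge-periodic⁻ : ∀ t l → bridge (t - + m) l ≡ bridge t (l + + n)
  bridge-periodic⁻ t l = sym (trans (cong (λ x → bridge x (l + + n)) (sym ([i-j]+j≡i t (+ m))))
                                    (bridge-periodic (t - + m) l))

  ptolemy-double-arrow : ∀ i k →
    bridge (i - + m) (k + + n) * bridge i k ≡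
    F (out (i - + m)) (out i) * F (inn k) (inn (k + + n)) + bridge i (k + + n) * bridge i (k + + n)
  ptolemy-double-arrow i k = trans
    (subst (λ x → bridge (i - + m) (k + + n) * bridge x k ≡
                  F (out (i - + m)) (out x) * F (inn (k + + n)) (inn k) + bridge x (k + + n) * bridge (i - + m) k)
           ([i-j]+j≡i i (+ m)) (ptolemy-short-bridging 1≤m ℕₚ.≤-refl 1≤n ℕₚ.≤-refl (i - + m) k))
    (cong₂ (λ x y → F (out (i - + m)) (out i) * x + bridge i (k + + n) * y)
           (symm (inn (k + + n)) (inn k)) (bridge-periodic⁻ i k))

  module Rows = SL₂Tiling.Periodic bridge-isSL₂Tiling m n bridge-periodic
  module Columns = SL₂Tiling.Periodic (transpose-isSL₂Tiling bridge-isSL₂Tiling) n m (flip bridge-periodic)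

  outerGrowth-recurrence : ∀ j i l → outerGrowth m F j * bridge i l ≡ bridge (i - + m) l + bridge (i + + m) l
  outerGrowth-recurrence = Rows.growth-recurrence -1ℤ

  innerGrowth-recurrence : ∀ j i k → innerGrowth n F j * bridge i k ≡ bridge i (k - + n) + bridge i (k + + n)
  innerGrowth-recurrence j i k =
    trans (cong (_* bridge i k)
                (cong₂ _-_ (innerEntry≡minor j (j + + suc n)) (innerEntry≡minor (j + 1ℤ) (j + + n))))
          (Columns.growth-recurrence 0ℤ j k i)
    where
    innerEntry≡minor : ∀ a c → innerEntry F a c ≡ minor (flip bridge) 0ℤ a c
    innerEntry≡minor a c = cong (_- bridge 1ℤ c * bridge 0ℤ a) (*-comm (bridge 0ℤ c) (bridge 1ℤ a))

cleared-growth-formula : ∀ s x₀ x₁ y c → s * x₁ ≡ y + x₀ → y * x₀ ≡ c + x₁ * x₁ →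
                         s * (x₀ * x₁) ≡ x₁ * x₁ + x₀ * x₀ + c
cleared-growth-formula s x₀ x₁ y c recurrence ptolemy = begin
  s * (x₀ * x₁)         ≡⟨ solve (s ∷ x₀ ∷ x₁ ∷ []) ⟩
  x₀ * (s * x₁)         ≡⟨ cong (x₀ *_) recurrence ⟩
  x₀ * (y + x₀)         ≡⟨ solve (x₀ ∷ y ∷ []) ⟩
  y * x₀ + x₀ * x₀      ≡⟨ cong (_+ x₀ * x₀) ptolemy ⟩
  c + x₁ * x₁ + x₀ * x₀ ≡⟨ solve (c ∷ x₀ ∷ x₁ ∷ []) ⟩
  x₁ * x₁ + x₀ * x₀ + c ∎
  where open ≡-Reasoning

proposition3p4 : (m n : ℕ) → 1 ≤ m → 1 ≤ n →
    (F : Pt → Pt → ℤ) → IsAnnulusFrieze m n F →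
    (i k : ℤ) →
    let x₀ = F (out i) (inn k)
        x₁ = F (out i) (inn (k + + n))
        xa = F (out (i - + m)) (out i)
        xb = F (inn k) (inn (k + + n))
    in ((j : ℤ) → outerGrowth m F j * (x₀ * x₁) ≡ x₁ * x₁ + x₀ * x₀ + xa * xb)
     × ((j : ℤ) → innerGrowth n F j * (x₀ * x₁) ≡ x₁ * x₁ + x₀ * x₀ + xa * xb)
proposition3p4 m n 1≤m 1≤n F frieze i k =
    (λ j → cleared-growth-formula (outerGrowth m F j) x₀ x₁ y (xa * xb)
             (trans (outerGrowth-recurrence j i (k + + n)) (cong (_+_ y) (bridge-periodic i k)))
             (ptolemy-double-arrow i k))
  , (λ j → cleared-growth-formula (innerGrowth n F j) x₀ x₁ y (xa * xb)
             (trans (innerGrowth-recurrence j i (k + + n))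
                    (trans (cong₂ _+_ (cong (bridge i) ([i+j]-j≡i k (+ n))) (sym (bridge-periodic⁻ i (k + + n))))
                           (+-comm x₀ y)))
             (ptolemy-double-arrow i k))
  where
  open AnnulusFrieze 1≤m 1≤n frieze
  x₀ x₁ y xa xb : ℤ
  x₀ = bridge i k
  x₁ = bridge i (k + + n)
  y  = bridge (i - + m) (k + + n)
  xa = F (out (i - + m)) (out i)
  xb = F (inn k) (inn (k + + n))
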